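{- (Uniformity.) For every $\mathsf{QMLL}$ proof $\pi$ and for every formula occurrence $A$ in $\pi$, context $C$ for $A$ and stack $s$, there exist a formula occurrence $B$, a context $D$, a stack $r$ and a unitary operator $U$ on $\mathbb C^{2^{d(C)+|s|}}$ such that for every quantum register $Q$ (so that $(A,C,s,Q)$ is a state of $\pi$), if $(A,C,s,Q)\to_\pi(A',E,q,R)$ then $A'=B$, $E=D$, $q=r$ and $R=U(Q)$.
   Context: $\mathsf{QMLL}$ formulas: $A ::= \alpha \mid \alpha^\perp \mid A\wp A \mid A\otimes A \mid \boxdot A \mid \Diamond A$ ($\alpha$ atoms; $\wp$ = par, $\otimes$ = tensor; $\boxdot,\Diamond$ dual modalities); negation: $(\alpha^\perp)^\perp=\alpha$, $(A\otimes B)^\perp=A^\perp\wp B^\perp$, $(A\wp B)^\perp=A^\perp\otimes B^\perp$, $(\boxdot A)^\perp=\Diamond A^\perp$, $(\Diamond A)^\perp=\boxdot A^\perp$; $\boxdot^nA,\Diamond^nA$ are $n$-fold prefixes; modal formulas are those of the form $\boxdot A$ or $\Diamond A$. $\mathcal U_n$ = unitary operators on $\mathbb C^{2^n}$. Rules: axiom $\vdash A^\perp,A$; cut: from $\vdash\Gamma,A$, $\vdash\Delta,A^\perp$ infer $\vdash\Gamma,\Delta$; par: from $\vdash\Gamma,A,B$ infer $\vdash\Gamma,A\wp B$; tensor: from $\vdash\Gamma,A$, $\vdash\Delta,B$ infer $\vdash\Gamma,\Delta,A\otimes B$; quantum rule $\mathsf{Q}_n$ labelled by $U\in\mathcal U_n$: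 from $\vdash A,B$ infer $\vdash\Diamond^nA,\boxdot^nB$, provided $A,B$ both modal or both non-modal. Proofs are finite trees of rule instances; formulas in them are considered as occurrences. A context is a formula with one hole: $C ::= [\cdot] \mid C\wp A \mid A\wp C \mid C\otimes A \mid A\otimes C \mid \boxdot C \mid \Diamond C$; $C[A]$ is the result of filling the hole with $A$. $C$ is a positive (resp. negative) context for $A$ if $A=C[\alpha]$ (resp. $A=C[\alpha^\perp]$) for an atom $\alpha$; letters $P$ and $N$ denote positive resp. negative contexts. The dual $C^\perp$ is defined by De Morgan (e.g. $(A\otimes C)^\perp=A^\perp\wp C^\perp$, $(\boxdot C)^\perp=\Diamond C^\perp$, $[\cdot]^\perp=[\cdot]$), so $N^\perp$ is a positive context for $A^\perp$. The nesting depth $d(C)$ is the number of modal operators enclosing the hole. A stack is a finite word over $\{\boxdot,\Diamond\}$; $|s|$ its length, $\varepsilon$ the empty stack. A state of $\pi$ is a quadruple $(A,C,s,Q)$ with $A$ a formula occurrence in $\pi$, $C$ a context for $A$, $s$ a stack and $Q$ a quantum register of $d(C)+|s|$ qubits (a unit vector of $\mathbb C^{2^{d(C)+|s|}}$). The transition relation $\to_\pi$ is defined locally for each rule instance of $\pi$ as follows (in each rule, a formula occurrence of a premise and the corresponding occurrence of the conclusion are distinguished by subscripts 2 and 1; "context formulas" are the non-principal ones): Axiom $\vdash A^\perp,A$: $(A,N,s,Q)\to(A^\perp,N^\perp,s,Q)$ and $(A^\perp,N,s,Q)\to(A,N^\perp,s,Q)$. Cut from $\vdash\Gamma_2,A$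 and $\vdash\Delta_2,A^\perp$ to $\vdash\Gamma_1,\Delta_1$: $(A,P,s,Q)\to(A^\perp,P^\perp,s,Q)$, $(A^\perp,P,s,Q)\to(A,P^\perp,s,Q)$; for each context formula, $(X_1,N,s,Q)\to(X_2,N,s,Q)$ and $(X_2,P,s,Q)\to(X_1,P,s,Q)$. Par from $\vdash\Gamma_2,A,B$ to $\vdash\Gamma_1,A\wp B$ (resp. tensor from $\vdash\Gamma_2,A$, $\vdash\Delta_2,B$ to $\vdash\Gamma_1,\Delta_1,A\otimes B$), writing $\star$ for $\wp$ (resp. $\otimes$): $(A\star B,N\star B,s,Q)\to(A,N,s,Q)$; $(A\star B,A\star N,s,Q)\to(B,N,s,Q)$; $(A,P,s,Q)\to(A\star B,P\star B,s,Q)$; $(B,P,s,Q)\to(A\star B,A\star P,s,Q)$; context formulas pass through as for cut. Quantum rule $\mathsf{Q}_n$ with label $U$, premise $\vdash A,B$, conclusion $\vdash\Diamond^nA,\boxdot^nB$: $(\Diamond^nA,\Diamond^nN,s,Q)\to(A,N,s\cdot\Diamond^n,Q)$; $(\boxdot^nB,\boxdot^nN,s,Q)\to(B,N,s\cdot\boxdot^n,Q)$; $(A,P,s\cdot\Diamond^n,Q)\to(\Diamond^nA,\Diamond^nP,s,Q)$; $(A,P,s\cdot\boxdot^n,Q)\to(\Diamond^nA,\Diamond^nP,s,(I_{d(P)}\otimes U^*\otimes I_{|s|})(Q))$; $(B,P,s\cdot\boxdot^n,Q)\to(\boxdot^nB,\boxdot^nP,s,Q)$; $(B,P,s\cdot\Diamond^n,Q)\to(\boxdot^nB,\boxdot^nP,s,(I_{d(P)}\otimes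 U\otimes I_{|s|})(Q))$, where $I_k$ is the identity on $\mathbb C^{2^k}$ and $U^*$ the adjoint of $U$. -}

module Defs where

open import Level using (Level; _⊔_) renaming (suc to lsuc)
open import Data.Nat using (ℕ; zero; suc; _+_; _≤_)
open import Data.Nat.Properties using (+-assoc; +-suc; +-comm)
open import Data.Bool using (Bool; true; false)
open import Data.Empty using (⊥)
open import Data.Product using (Σ; _×_; _,_)
open import Data.Sum using (_⊎_)
open import Data.Vec using (Vec; []; _∷_; splitAt) renaming (_++_ to _++ᵥ_)
open import Data.List using (List; []; _∷_; length; replicate) renaming (_++_ to _++ₗ_)
open import Data.List.Properties using (length-++; length-replicate)
open import Data.List.Membership.Propositional using (_∈_)
open import Data.List.Relation.Unary.Any using (here; there)
open import Data.List.Relation.Unary.Any.Properties using (++⁺ˡ; ++⁺ʳ)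
open import Data.List.Relation.Binary.Permutation.Propositional using (_↭_; ↭-sym)
open import Data.List.Relation.Binary.Permutation.Propositional.Properties using (∈-resp-↭)
open import Relation.Binary.PropositionalEquality using (_≡_; refl; subst; cong; sym; trans)
open import Algebra.Bundles using (CommutativeRing)

-- Scalars: a commutative ring with an involution (conjugation).
-- ℂ with complex conjugation is the intended instance.

record StarCommRing (c ℓ : Level) : Set (lsuc (c ⊔ ℓ)) where
  field
    ring : CommutativeRing c ℓ
  open CommutativeRing ring using (Carrier; _≈_; 1#) renaming (_+_ to _+ₖ_; _*_ to _*ₖ_)
  field
    conj        : Carrier → Carrier
    conj-cong   : ∀ {x y} → x ≈ y → conj x ≈ conj y
    conj-invol  : ∀ x → conj (conj x) ≈ x
    conj-+      : ∀ x y → conj (x +ₖ y) ≈ conj x +ₖ conj y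
    conj-*      : ∀ x y → conj (x *ₖ y) ≈ conj x *ₖ conj y
    conj-1      : conj 1# ≈ 1#

Atom : Set
Atom = ℕ

infixr 6 _⅋_ _⊗_

data Formula : Set where
  atom : Atom → Formula
  natom : Atom → Formula
  _⅋_ : Formula → Formula → Formula
  _⊗_ : Formula → Formula → Formula
  ⊡ : Formula → Formula
  ◇ : Formula → Formula

_^⊥ : Formula → Formula
atom α ^⊥ = natom α
natom α ^⊥ = atom α
(A ⅋ B) ^⊥ = (A ^⊥) ⊗ (B ^⊥)
(A ⊗ B) ^⊥ = (A ^⊥) ⅋ (B ^⊥)
⊡ A ^⊥ = ◇ (A ^⊥)
◇ A ^⊥ = ⊡ (A ^⊥)

⊡^ : ℕ → Formula → Formula
⊡^ zero A = A
⊡^ (suc n) A = ⊡ (⊡^ n A)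

◇^ : ℕ → Formula → Formula
◇^ zero A = A
◇^ (suc n) A = ◇ (◇^ n A)

data Modal : Formula → Set where
  modal⊡ : ∀ {A} → Modal (⊡ A)
  modal◇ : ∀ {A} → Modal (◇ A)

SameKind : Formula → Formula → Set
SameKind A B = (Modal A × Modal B) ⊎ ((Modal A → ⊥) × (Modal B → ⊥))

data Ctx : Set where
  hole : Ctx
  _⅋ₗ_ : Ctx → Formula → Ctx
  _⅋ᵣ_ : Formula → Ctx → Ctx
  _⊗ₗ_ : Ctx → Formula → Ctx
  _⊗ᵣ_ : Formula → Ctx → Ctx
  ⊡c : Ctx → Ctx
  ◇c : Ctx → Ctx

plug : Ctx → Formula → Formula
plug hole X = X
plug (C ⅋ₗ A) X = plug C X ⅋ A
plug (A ⅋ᵣ C) X = A ⅋ plug C X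
plug (C ⊗ₗ A) X = plug C X ⊗ A
plug (A ⊗ᵣ C) X = A ⊗ plug C X
plug (⊡c C) X = ⊡ (plug C X)
plug (◇c C) X = ◇ (plug C X)

dualC : Ctx → Ctx
dualC hole = hole
dualC (C ⅋ₗ A) = dualC C ⊗ₗ (A ^⊥)
dualC (A ⅋ᵣ C) = (A ^⊥) ⊗ᵣ dualC C
dualC (C ⊗ₗ A) = dualC C ⅋ₗ (A ^⊥)
dualC (A ⊗ᵣ C) = (A ^⊥) ⅋ᵣ dualC C
dualC (⊡c C) = ◇c (dualC C)
dualC (◇c C) = ⊡c (dualC C)

d : Ctx → ℕ
d hole = 0
d (C ⅋ₗ A) = d C
d (A ⅋ᵣ C) = d C
d (C ⊗ₗ A) = d C
d (A ⊗ᵣ C) = d C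
d (⊡c C) = suc (d C)
d (◇c C) = suc (d C)

⊡c^ : ℕ → Ctx → Ctx
⊡c^ zero C = C
⊡c^ (suc n) C = ⊡c (⊡c^ n C)

◇c^ : ℕ → Ctx → Ctx
◇c^ zero C = C
◇c^ (suc n) C = ◇c (◇c^ n C)

PosCtx : Ctx → Formula → Set
PosCtx C A = Σ Atom λ α → plug C (atom α) ≡ A

NegCtx : Ctx → Formula → Set
NegCtx C A = Σ Atom λ α → plug C (natom α) ≡ A

CtxFor : Ctx → Formula → Set
CtxFor C A = PosCtx C A ⊎ NegCtx C A

data Mod : Set where
  m⊡ m◇ : Mod

Stack : Set
Stack = List Mod

-- Arithmetic facts on sizes (used to reinterpret registers; these are
-- equalities of natural numbers, the register vector is unchanged)

d-dualC : ∀ C → d (dualC C) ≡ d C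
d-dualC hole = refl
d-dualC (C ⅋ₗ A) = d-dualC C
d-dualC (A ⅋ᵣ C) = d-dualC C
d-dualC (C ⊗ₗ A) = d-dualC C
d-dualC (A ⊗ᵣ C) = d-dualC C
d-dualC (⊡c C) = cong suc (d-dualC C)
d-dualC (◇c C) = cong suc (d-dualC C)

d-⊡c^ : ∀ n C → d (⊡c^ n C) ≡ d C + n
d-⊡c^ zero C = sym (+-comm (d C) 0)
d-⊡c^ (suc n) C = trans (cong suc (d-⊡c^ n C)) (sym (+-suc (d C) n))

d-◇c^ : ∀ n C → d (◇c^ n C) ≡ d C + n
d-◇c^ zero C = sym (+-comm (d C) 0)
d-◇c^ (suc n) C = trans (cong suc (d-◇c^ n C)) (sym (+-suc (d C) n))

len-push : ∀ (s : Stack) n m → length (s ++ₗ replicate n m) ≡ length s + n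
len-push s n m = trans (length-++ s) (cong (length s +_) (length-replicate n))

push-eq : ∀ k (s : Stack) n m → k + length (s ++ₗ replicate n m) ≡ (k + n) + length s
push-eq k s n m = trans (cong (k +_) (trans (len-push s n m) (+-comm (length s) n)))
                        (sym (+-assoc k n (length s)))

module QMLL {c ℓ : Level} (K : StarCommRing c ℓ) where
  open StarCommRing K using (ring; conj)
  open CommutativeRing ring using (Carrier; _≈_; 0#; 1#) renaming (_+_ to _+ₖ_; _*_ to _*ₖ_)

  -- registers of k qubits: vectors of C^(2^k), indexed by the
  -- computational basis {0,1}^k (first bit = first tensor factor)
  Reg : ℕ → Set c
  Reg k = Vec Bool k → Carrier

  Matrix : ℕ → Set c
  Matrix k = Vec Bool k → Vec Bool k → Carrier

  sumV : ∀ k → (Vec Bool k → Carrier) → Carrier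
  sumV zero f = f []
  sumV (suc k) f = sumV k (λ v → f (false ∷ v)) +ₖ sumV k (λ v → f (true ∷ v))

  δ : ∀ {k} → Vec Bool k → Vec Bool k → Carrier
  δ [] [] = 1#
  δ (false ∷ x) (false ∷ y) = δ x y
  δ (true ∷ x) (true ∷ y) = δ x y
  δ (false ∷ x) (true ∷ y) = 0#
  δ (true ∷ x) (false ∷ y) = 0#

  _·ₘ_ : ∀ {k} → Matrix k → Matrix k → Matrix k
  _·ₘ_ {k} M N x y = sumV k (λ z → M x z *ₖ N z y)

  adj : ∀ {k} → Matrix k → Matrix k
  adj M x y = conj (M y x)

  IsUnitary : ∀ {k} → Matrix k → Set ℓ
  IsUnitary M = (∀ x y → (adj M ·ₘ M) x y ≈ δ x y) × (∀ x y → (M ·ₘ adj M) x y ≈ δ x y)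

  Unitary : ℕ → Set (c ⊔ ℓ)
  Unitary k = Σ (Matrix k) IsUnitary

  apply : ∀ {k} → Matrix k → Reg k → Reg k
  apply {k} M Q x = sumV k (λ y → M x y *ₖ Q y)

  applyU : ∀ {k} → Unitary k → Reg k → Reg k
  applyU (M , _) = apply M

  IsUnitVector : ∀ {k} → Reg k → Set ℓ
  IsUnitVector {k} Q = sumV k (λ v → conj (Q v) *ₖ Q v) ≈ 1#

  -- (I_a ⊗ M ⊗ I_b) acting on a register of a + n + b qubits
  kron : ∀ a n b → Matrix n → Reg ((a + n) + b) → Reg ((a + n) + b)
  kron a n b M Q v with splitAt (a + n) v
  ... | xy , z , _ with splitAt a xy
  ...   | x , y , _ = sumV n (λ y' → M y y' *ₖ Q ((x ++ᵥ y') ++ᵥ z))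

  castR : ∀ {m n} → m ≡ n → Reg m → Reg n
  castR e Q = subst Reg e Q

  RegEq : ∀ {m n} → Reg m → Reg n → Set ℓ
  RegEq {m} {n} R Q = Σ (m ≡ n) λ e → ∀ v → castR e R v ≈ Q v

  -- Proofs. Sequents are lists taken up to permutation: every rule
  -- instance has an arbitrary conclusion Σ together with a permutation
  -- ρ relating it to the canonical conclusion of the rule.

  data Proof : List Formula → Set (c ⊔ ℓ) where
    ax  : ∀ {Σ'} A → Σ' ↭ ((A ^⊥) ∷ A ∷ []) → Proof Σ'
    cut : ∀ {Σ' Γ Δ} A → Proof (A ∷ Γ) → Proof ((A ^⊥) ∷ Δ) → Σ' ↭ (Γ ++ₗ Δ) → Proof Σ'
    par : ∀ {Σ' Γ} A B → Proof (A ∷ B ∷ Γ) → Σ' ↭ ((A ⅋ B) ∷ Γ) → Proof Σ'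
    ten : ∀ {Σ' Γ Δ} A B → Proof (A ∷ Γ) → Proof (B ∷ Δ) → Σ' ↭ ((A ⊗ B) ∷ Γ ++ₗ Δ) → Proof Σ'
    qr  : ∀ {Σ'} n A B → 1 ≤ n → SameKind A B → Unitary n →
          Proof (A ∷ B ∷ []) → Σ' ↭ (◇^ n A ∷ ⊡^ n B ∷ []) → Proof Σ'

  fr : ∀ {Σ' Γ} {X : Formula} → Σ' ↭ Γ → X ∈ Γ → X ∈ Σ'
  fr ρ = ∈-resp-↭ (↭-sym ρ)

  -- formula occurrences in a proof: a position in the conclusion of some
  -- rule instance
  data Occ : ∀ {Γ} → Proof Γ → Set (c ⊔ ℓ) where
    oroot : ∀ {Γ} {π : Proof Γ} {X} → X ∈ Γ → Occ π
    ocut₁ : ∀ {Σ' Γ Δ A} {π₁ : Proof (A ∷ Γ)} {π₂ : Proof ((A ^⊥) ∷ Δ)} {ρ : Σ' ↭ (Γ ++ₗ Δ)} →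
            Occ π₁ → Occ (cut A π₁ π₂ ρ)
    ocut₂ : ∀ {Σ' Γ Δ A} {π₁ : Proof (A ∷ Γ)} {π₂ : Proof ((A ^⊥) ∷ Δ)} {ρ : Σ' ↭ (Γ ++ₗ Δ)} →
            Occ π₂ → Occ (cut A π₁ π₂ ρ)
    opar  : ∀ {Σ' Γ A B} {π₁ : Proof (A ∷ B ∷ Γ)} {ρ : Σ' ↭ ((A ⅋ B) ∷ Γ)} →
            Occ π₁ → Occ (par A B π₁ ρ)
    oten₁ : ∀ {Σ' Γ Δ A B} {π₁ : Proof (A ∷ Γ)} {π₂ : Proof (B ∷ Δ)} {ρ : Σ' ↭ ((A ⊗ B) ∷ Γ ++ₗ Δ)} →
            Occ π₁ → Occ (ten A B π₁ π₂ ρ)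
    oten₂ : ∀ {Σ' Γ Δ A B} {π₁ : Proof (A ∷ Γ)} {π₂ : Proof (B ∷ Δ)} {ρ : Σ' ↭ ((A ⊗ B) ∷ Γ ++ₗ Δ)} →
            Occ π₂ → Occ (ten A B π₁ π₂ ρ)
    oq    : ∀ {Σ' n A B} {h : 1 ≤ n} {k : SameKind A B} {U : Unitary n} {π₁ : Proof (A ∷ B ∷ [])}
              {ρ : Σ' ↭ (◇^ n A ∷ ⊡^ n B ∷ [])} →
            Occ π₁ → Occ (qr n A B h k U π₁ ρ)

  occF : ∀ {Γ} {π : Proof Γ} → Occ π → Formula
  occF (oroot {X = X} _) = X
  occF (ocut₁ o) = occF o
  occF (ocut₂ o) = occF o
  occF (opar o) = occF o
  occF (oten₁ o) = occF o
  occF (oten₂ o) = occF o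
  occF (oq o) = occF o

  record State {Γ} (π : Proof Γ) : Set (c ⊔ ℓ) where
    constructor ⟨_,_,_,_⟩
    field
      occ : Occ π
      ctx : Ctx
      stk : Stack
      reg : Reg (d ctx + length stk)

  data RootStep : ∀ {Γ} (π : Proof Γ) → State π → State π → Set (c ⊔ ℓ) where
    ax-A : ∀ {Σ' A N s Q} {ρ : Σ' ↭ ((A ^⊥) ∷ A ∷ [])} → NegCtx N A →
      RootStep (ax A ρ) ⟨ oroot (fr ρ (there (here refl))) , N , s , Q ⟩
                        ⟨ oroot (fr ρ (here refl)) , dualC N , s ,
                          castR (cong (_+ length s) (sym (d-dualC N))) Q ⟩
    ax-A⊥ : ∀ {Σ' A N s Q} {ρ : Σ' ↭ ((A ^⊥) ∷ A ∷ [])} → NegCtx N (A ^⊥) →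
      RootStep (ax A ρ) ⟨ oroot (fr ρ (here refl)) , N , s , Q ⟩
                        ⟨ oroot (fr ρ (there (here refl))) , dualC N , s ,
                          castR (cong (_+ length s) (sym (d-dualC N))) Q ⟩
    cut-A : ∀ {Σ' Γ Δ A P s Q} {π₁ : Proof (A ∷ Γ)} {π₂ : Proof ((A ^⊥) ∷ Δ)} {ρ : Σ' ↭ (Γ ++ₗ Δ)} →
      PosCtx P A →
      RootStep (cut A π₁ π₂ ρ) ⟨ ocut₁ (oroot (here refl)) , P , s , Q ⟩
                               ⟨ ocut₂ (oroot (here refl)) , dualC P , s ,
                                 castR (cong (_+ length s) (sym (d-dualC P))) Q ⟩
    cut-A⊥ : ∀ {Σ' Γ Δ A P s Q} {π₁ : Proof (A ∷ Γ)} {π₂ : Proof ((A ^⊥) ∷ Δ)} {ρ : Σ' ↭ (Γ ++ₗ Δ)} →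
      PosCtx P (A ^⊥) →
      RootStep (cut A π₁ π₂ ρ) ⟨ ocut₂ (oroot (here refl)) , P , s , Q ⟩
                               ⟨ ocut₁ (oroot (here refl)) , dualC P , s ,
                                 castR (cong (_+ length s) (sym (d-dualC P))) Q ⟩
    cut-upΓ : ∀ {Σ' Γ Δ A X N s Q} {π₁ : Proof (A ∷ Γ)} {π₂ : Proof ((A ^⊥) ∷ Δ)} {ρ : Σ' ↭ (Γ ++ₗ Δ)} →
      (q : X ∈ Γ) → NegCtx N X →
      RootStep (cut A π₁ π₂ ρ) ⟨ oroot (fr ρ (++⁺ˡ q)) , N , s , Q ⟩ ⟨ ocut₁ (oroot (there q)) , N , s , Q ⟩
    cut-upΔ : ∀ {Σ' Γ Δ A X N s Q} {π₁ : Proof (A ∷ Γ)} {π₂ : Proof ((A ^⊥) ∷ Δ)} {ρ : Σ' ↭ (Γ ++ₗ Δ)} →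
      (q : X ∈ Δ) → NegCtx N X →
      RootStep (cut A π₁ π₂ ρ) ⟨ oroot (fr ρ (++⁺ʳ Γ q)) , N , s , Q ⟩ ⟨ ocut₂ (oroot (there q)) , N , s , Q ⟩
    cut-downΓ : ∀ {Σ' Γ Δ A X P s Q} {π₁ : Proof (A ∷ Γ)} {π₂ : Proof ((A ^⊥) ∷ Δ)} {ρ : Σ' ↭ (Γ ++ₗ Δ)} →
      (q : X ∈ Γ) → PosCtx P X →
      RootStep (cut A π₁ π₂ ρ) ⟨ ocut₁ (oroot (there q)) , P , s , Q ⟩ ⟨ oroot (fr ρ (++⁺ˡ q)) , P , s , Q ⟩
    cut-downΔ : ∀ {Σ' Γ Δ A X P s Q} {π₁ : Proof (A ∷ Γ)} {π₂ : Proof ((A ^⊥) ∷ Δ)} {ρ : Σ' ↭ (Γ ++ₗ Δ)} →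
      (q : X ∈ Δ) → PosCtx P X →
      RootStep (cut A π₁ π₂ ρ) ⟨ ocut₂ (oroot (there q)) , P , s , Q ⟩ ⟨ oroot (fr ρ (++⁺ʳ Γ q)) , P , s , Q ⟩
    par-upA : ∀ {Σ' Γ A B N s Q} {π₁ : Proof (A ∷ B ∷ Γ)} {ρ : Σ' ↭ ((A ⅋ B) ∷ Γ)} → NegCtx N A →
      RootStep (par A B π₁ ρ) ⟨ oroot (fr ρ (here refl)) , N ⅋ₗ B , s , Q ⟩
                              ⟨ opar (oroot (here refl)) , N , s , Q ⟩
    par-upB : ∀ {Σ' Γ A B N s Q} {π₁ : Proof (A ∷ B ∷ Γ)} {ρ : Σ' ↭ ((A ⅋ B) ∷ Γ)} → NegCtx N B →
      RootStep (par A B π₁ ρ) ⟨ oroot (fr ρ (here refl)) , A ⅋ᵣ N , s , Q ⟩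
                              ⟨ opar (oroot (there (here refl))) , N , s , Q ⟩
    par-downA : ∀ {Σ' Γ A B P s Q} {π₁ : Proof (A ∷ B ∷ Γ)} {ρ : Σ' ↭ ((A ⅋ B) ∷ Γ)} → PosCtx P A →
      RootStep (par A B π₁ ρ) ⟨ opar (oroot (here refl)) , P , s , Q ⟩
                              ⟨ oroot (fr ρ (here refl)) , P ⅋ₗ B , s , Q ⟩
    par-downB : ∀ {Σ' Γ A B P s Q} {π₁ : Proof (A ∷ B ∷ Γ)} {ρ : Σ' ↭ ((A ⅋ B) ∷ Γ)} → PosCtx P B →
      RootStep (par A B π₁ ρ) ⟨ opar (oroot (there (here refl))) , P , s , Q ⟩
                              ⟨ oroot (fr ρ (here refl)) , A ⅋ᵣ P , s , Q ⟩
    par-up : ∀ {Σ' Γ A B X N s Q} {π₁ : Proof (A ∷ B ∷ Γ)} {ρ : Σ' ↭ ((A ⅋ B) ∷ Γ)} →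
      (q : X ∈ Γ) → NegCtx N X →
      RootStep (par A B π₁ ρ) ⟨ oroot (fr ρ (there q)) , N , s , Q ⟩
                              ⟨ opar (oroot (there (there q))) , N , s , Q ⟩
    par-down : ∀ {Σ' Γ A B X P s Q} {π₁ : Proof (A ∷ B ∷ Γ)} {ρ : Σ' ↭ ((A ⅋ B) ∷ Γ)} →
      (q : X ∈ Γ) → PosCtx P X →
      RootStep (par A B π₁ ρ) ⟨ opar (oroot (there (there q))) , P , s , Q ⟩
                              ⟨ oroot (fr ρ (there q)) , P , s , Q ⟩
    ten-upA : ∀ {Σ' Γ Δ A B N s Q} {π₁ : Proof (A ∷ Γ)} {π₂ : Proof (B ∷ Δ)} {ρ : Σ' ↭ ((A ⊗ B) ∷ Γ ++ₗ Δ)} →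
      NegCtx N A →
      RootStep (ten A B π₁ π₂ ρ) ⟨ oroot (fr ρ (here refl)) , N ⊗ₗ B , s , Q ⟩
                                 ⟨ oten₁ (oroot (here refl)) , N , s , Q ⟩
    ten-upB : ∀ {Σ' Γ Δ A B N s Q} {π₁ : Proof (A ∷ Γ)} {π₂ : Proof (B ∷ Δ)} {ρ : Σ' ↭ ((A ⊗ B) ∷ Γ ++ₗ Δ)} →
      NegCtx N B →
      RootStep (ten A B π₁ π₂ ρ) ⟨ oroot (fr ρ (here refl)) , A ⊗ᵣ N , s , Q ⟩
                                 ⟨ oten₂ (oroot (here refl)) , N , s , Q ⟩
    ten-downA : ∀ {Σ' Γ Δ A B P s Q} {π₁ : Proof (A ∷ Γ)} {π₂ : Proof (B ∷ Δ)} {ρ : Σ' ↭ ((A ⊗ B) ∷ Γ ++ₗ Δ)} →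
      PosCtx P A →
      RootStep (ten A B π₁ π₂ ρ) ⟨ oten₁ (oroot (here refl)) , P , s , Q ⟩
                                 ⟨ oroot (fr ρ (here refl)) , P ⊗ₗ B , s , Q ⟩
    ten-downB : ∀ {Σ' Γ Δ A B P s Q} {π₁ : Proof (A ∷ Γ)} {π₂ : Proof (B ∷ Δ)} {ρ : Σ' ↭ ((A ⊗ B) ∷ Γ ++ₗ Δ)} →
      PosCtx P B →
      RootStep (ten A B π₁ π₂ ρ) ⟨ oten₂ (oroot (here refl)) , P , s , Q ⟩
                                 ⟨ oroot (fr ρ (here refl)) , A ⊗ᵣ P , s , Q ⟩
    ten-upΓ : ∀ {Σ' Γ Δ A B X N s Q} {π₁ : Proof (A ∷ Γ)} {π₂ : Proof (B ∷ Δ)} {ρ : Σ' ↭ ((A ⊗ B) ∷ Γ ++ₗ Δ)} →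
      (q : X ∈ Γ) → NegCtx N X →
      RootStep (ten A B π₁ π₂ ρ) ⟨ oroot (fr ρ (there (++⁺ˡ q))) , N , s , Q ⟩
                                 ⟨ oten₁ (oroot (there q)) , N , s , Q ⟩
    ten-upΔ : ∀ {Σ' Γ Δ A B X N s Q} {π₁ : Proof (A ∷ Γ)} {π₂ : Proof (B ∷ Δ)} {ρ : Σ' ↭ ((A ⊗ B) ∷ Γ ++ₗ Δ)} →
      (q : X ∈ Δ) → NegCtx N X →
      RootStep (ten A B π₁ π₂ ρ) ⟨ oroot (fr ρ (there (++⁺ʳ Γ q))) , N , s , Q ⟩
                                 ⟨ oten₂ (oroot (there q)) , N , s , Q ⟩
    ten-downΓ : ∀ {Σ' Γ Δ A B X P s Q} {π₁ : Proof (A ∷ Γ)} {π₂ : Proof (B ∷ Δ)} {ρ : Σ' ↭ ((A ⊗ B) ∷ Γ ++ₗ Δ)} →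
      (q : X ∈ Γ) → PosCtx P X →
      RootStep (ten A B π₁ π₂ ρ) ⟨ oten₁ (oroot (there q)) , P , s , Q ⟩
                                 ⟨ oroot (fr ρ (there (++⁺ˡ q))) , P , s , Q ⟩
    ten-downΔ : ∀ {Σ' Γ Δ A B X P s Q} {π₁ : Proof (A ∷ Γ)} {π₂ : Proof (B ∷ Δ)} {ρ : Σ' ↭ ((A ⊗ B) ∷ Γ ++ₗ Δ)} →
      (q : X ∈ Δ) → PosCtx P X →
      RootStep (ten A B π₁ π₂ ρ) ⟨ oten₂ (oroot (there q)) , P , s , Q ⟩
                                 ⟨ oroot (fr ρ (there (++⁺ʳ Γ q))) , P , s , Q ⟩
    q-upA : ∀ {Σ' n A B h k U N s Q} {π₁ : Proof (A ∷ B ∷ [])} {ρ : Σ' ↭ (◇^ n A ∷ ⊡^ n B ∷ [])} →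
      NegCtx N A →
      RootStep (qr n A B h k U π₁ ρ)
        ⟨ oroot (fr ρ (here refl)) , ◇c^ n N , s , Q ⟩
        ⟨ oq (oroot (here refl)) , N , s ++ₗ replicate n m◇ ,
          castR (sym (trans (push-eq (d N) s n m◇) (cong (_+ length s) (sym (d-◇c^ n N))))) Q ⟩
    q-upB : ∀ {Σ' n A B h k U N s Q} {π₁ : Proof (A ∷ B ∷ [])} {ρ : Σ' ↭ (◇^ n A ∷ ⊡^ n B ∷ [])} →
      NegCtx N B →
      RootStep (qr n A B h k U π₁ ρ)
        ⟨ oroot (fr ρ (there (here refl))) , ⊡c^ n N , s , Q ⟩
        ⟨ oq (oroot (there (here refl))) , N , s ++ₗ replicate n m⊡ ,
          castR (sym (trans (push-eq (d N) s n m⊡) (cong (_+ length s) (sym (d-⊡c^ n N))))) Q ⟩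
    q-downA◇ : ∀ {Σ' n A B h k U P s Q} {π₁ : Proof (A ∷ B ∷ [])} {ρ : Σ' ↭ (◇^ n A ∷ ⊡^ n B ∷ [])} →
      PosCtx P A →
      RootStep (qr n A B h k U π₁ ρ)
        ⟨ oq (oroot (here refl)) , P , s ++ₗ replicate n m◇ , Q ⟩
        ⟨ oroot (fr ρ (here refl)) , ◇c^ n P , s ,
          castR (trans (push-eq (d P) s n m◇) (cong (_+ length s) (sym (d-◇c^ n P)))) Q ⟩
    q-downA⊡ : ∀ {Σ' n A B h k U P s Q} {π₁ : Proof (A ∷ B ∷ [])} {ρ : Σ' ↭ (◇^ n A ∷ ⊡^ n B ∷ [])} →
      PosCtx P A →
      RootStep (qr n A B h k U π₁ ρ)
        ⟨ oq (oroot (here refl)) , P , s ++ₗ replicate n m⊡ , Q ⟩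
        ⟨ oroot (fr ρ (here refl)) , ◇c^ n P , s ,
          castR (cong (_+ length s) (sym (d-◇c^ n P)))
            (kron (d P) n (length s) (adj (Σ.proj₁ U)) (castR (push-eq (d P) s n m⊡) Q)) ⟩
    q-downB⊡ : ∀ {Σ' n A B h k U P s Q} {π₁ : Proof (A ∷ B ∷ [])} {ρ : Σ' ↭ (◇^ n A ∷ ⊡^ n B ∷ [])} →
      PosCtx P B →
      RootStep (qr n A B h k U π₁ ρ)
        ⟨ oq (oroot (there (here refl))) , P , s ++ₗ replicate n m⊡ , Q ⟩
        ⟨ oroot (fr ρ (there (here refl))) , ⊡c^ n P , s ,
          castR (trans (push-eq (d P) s n m⊡) (cong (_+ length s) (sym (d-⊡c^ n P)))) Q ⟩
    q-downB◇ : ∀ {Σ' n A B h k U P s Q} {π₁ : Proof (A ∷ B ∷ [])} {ρ : Σ' ↭ (◇^ n A ∷ ⊡^ n B ∷ [])} →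
      PosCtx P B →
      RootStep (qr n A B h k U π₁ ρ)
        ⟨ oq (oroot (there (here refl))) , P , s ++ₗ replicate n m◇ , Q ⟩
        ⟨ oroot (fr ρ (there (here refl))) , ⊡c^ n P , s ,
          castR (cong (_+ length s) (sym (d-⊡c^ n P)))
            (kron (d P) n (length s) (Σ.proj₁ U) (castR (push-eq (d P) s n m◇) Q)) ⟩

  -- The transition relation →_π : union of the local transitions of all
  -- rule instances of π

  lift : ∀ {Γ Γ'} {π : Proof Γ} {π' : Proof Γ'} → (Occ π → Occ π') → State π → State π'
  lift f ⟨ o , C , s , Q ⟩ = ⟨ f o , C , s , Q ⟩

  data Step : ∀ {Γ} (π : Proof Γ) → State π → State π → Set (c ⊔ ℓ) where
    root : ∀ {Γ} {π : Proof Γ} {S T} → RootStep π S T → Step π S T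
    cut₁ : ∀ {Σ' Γ Δ A} {π₁ : Proof (A ∷ Γ)} {π₂ : Proof ((A ^⊥) ∷ Δ)} {ρ : Σ' ↭ (Γ ++ₗ Δ)} {S T} →
           Step π₁ S T → Step (cut A π₁ π₂ ρ) (lift ocut₁ S) (lift ocut₁ T)
    cut₂ : ∀ {Σ' Γ Δ A} {π₁ : Proof (A ∷ Γ)} {π₂ : Proof ((A ^⊥) ∷ Δ)} {ρ : Σ' ↭ (Γ ++ₗ Δ)} {S T} →
           Step π₂ S T → Step (cut A π₁ π₂ ρ) (lift ocut₂ S) (lift ocut₂ T)
    par₁ : ∀ {Σ' Γ A B} {π₁ : Proof (A ∷ B ∷ Γ)} {ρ : Σ' ↭ ((A ⅋ B) ∷ Γ)} {S T} →
           Step π₁ S T → Step (par A B π₁ ρ) (lift opar S) (lift opar T)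
    ten₁ : ∀ {Σ' Γ Δ A B} {π₁ : Proof (A ∷ Γ)} {π₂ : Proof (B ∷ Δ)} {ρ : Σ' ↭ ((A ⊗ B) ∷ Γ ++ₗ Δ)} {S T} →
           Step π₁ S T → Step (ten A B π₁ π₂ ρ) (lift oten₁ S) (lift oten₁ T)
    ten₂ : ∀ {Σ' Γ Δ A B} {π₁ : Proof (A ∷ Γ)} {π₂ : Proof (B ∷ Δ)} {ρ : Σ' ↭ ((A ⊗ B) ∷ Γ ++ₗ Δ)} {S T} →
           Step π₂ S T → Step (ten A B π₁ π₂ ρ) (lift oten₂ S) (lift oten₂ T)
    q₁   : ∀ {Σ' n A B} {h : 1 ≤ n} {k : SameKind A B} {U : Unitary n} {π₁ : Proof (A ∷ B ∷ [])}
             {ρ : Σ' ↭ (◇^ n A ∷ ⊡^ n B ∷ [])} {S T} →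
           Step π₁ S T → Step (qr n A B h k U π₁ ρ) (lift oq S) (lift oq T)

module Submission where

-- Every local transition computes the next occurrence, context and stack
-- from the current ones alone, and either only reinterprets the register
-- or acts on it by I ⊗ U ⊗ I for the label U of a quantum rule.  We make
-- this explicit: for every proof π, occurrence A, context C for A and stack
-- s we compute an Outcome (next occurrence, context, stack and a unitary)
-- and show that every transition from (A, C, s, Q), for any register Q,
-- has this outcome.

open import Defs
open import Level using (Level; _⊔_)
open import Function using (_∘_)
open import Data.Nat using (ℕ; zero; suc; _+_; _≤_)
open import Data.Nat.Properties using (≡-irrelevant)
open import Data.Bool using (Bool; true; false)
open import Data.Empty using (⊥; ⊥-elim)
open import Data.Maybe using (Maybe; just; nothing; maybe′)
open import Data.Product using (Σ; _×_; _,_; proj₁)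
open import Data.Sum using (inj₁; inj₂; [_,_]′)
open import Data.Vec using (Vec; []; _∷_; take; drop; splitAt) renaming (_++_ to _++ᵥ_)
open import Data.Vec.Properties using (take++drop≡id; ++-injectiveˡ; ++-injectiveʳ)
open import Data.List using (List; []; _∷_; length; replicate; _∷ʳ_) renaming (_++_ to _++ₗ_)
open import Data.List.Properties using (++-assoc; ++-cancelʳ; ∷ʳ-injective; ++-monoid)
open import Data.List.Membership.Propositional using (_∈_)
open import Data.List.Relation.Unary.Any using (here; there)
open import Data.List.Relation.Unary.Any.Properties using (++⁺ˡ; ++⁺ʳ; ++⁻; ++⁻∘++⁺)
open import Data.List.Relation.Binary.Permutation.Propositional using (_↭_)
open import Data.List.Relation.Binary.Permutation.Propositional.Properties using (∈-resp-↭; ∈-resp-[σ∘σ⁻¹])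
open import Data.List.Relation.Binary.Suffix.Heterogeneous.Properties using (suffix?)
open import Data.List.Relation.Binary.Suffix.Propositional.Properties using (Suffix-as-∣ʳ; ∣ʳ-as-Suffix)
open import Algebra.Bundles using (CommutativeRing)
open import Relation.Nullary using (Dec; yes; no; ¬_)
open import Relation.Binary.Definitions using (DecidableEquality)
import Relation.Nullary.Decidable as Dec
open import Relation.Binary.PropositionalEquality using (_≡_; refl; sym; trans; cong; cong₂; subst)

module LinearAlgebra {c ℓ : Level} (K : StarCommRing c ℓ) where
  open StarCommRing K using (ring; conj; conj-cong; conj-invol; conj-+; conj-*; conj-1)
  open QMLL K
  open CommutativeRing ring
    using (Carrier; _≈_; 0#; setoid; +-cong; *-cong; *-assoc; *-comm; distribˡ; distribʳ;
           zeroˡ; *-identityˡ; +-identityˡ; +-identityʳ; +-group; *-commutativeSemigroup)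
    renaming (_+_ to _+ₖ_; _*_ to _*ₖ_; refl to ≈-refl; sym to ≈-sym; trans to ≈-trans;
              reflexive to ≈-reflexive)
  open import Relation.Binary.Reasoning.Setoid setoid
  open import Algebra.Properties.Group +-group using (identityʳ-unique)
  open import Algebra.Properties.CommutativeSemigroup *-commutativeSemigroup using (interchange)

  sumV-cong : ∀ k {f g : Vec Bool k → Carrier} → (∀ v → f v ≈ g v) → sumV k f ≈ sumV k g
  sumV-cong zero    f≈g = f≈g []
  sumV-cong (suc k) f≈g = +-cong (sumV-cong k (f≈g ∘ (false ∷_))) (sumV-cong k (f≈g ∘ (true ∷_)))

  sumV-*ˡ : ∀ k a (f : Vec Bool k → Carrier) → a *ₖ sumV k f ≈ sumV k (λ v → a *ₖ f v)
  sumV-*ˡ zero    a f = ≈-refl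
  sumV-*ˡ (suc k) a f = ≈-trans (distribˡ a _ _) (+-cong (sumV-*ˡ k a _) (sumV-*ˡ k a _))

  sumV-*ʳ : ∀ k a (f : Vec Bool k → Carrier) → sumV k f *ₖ a ≈ sumV k (λ v → f v *ₖ a)
  sumV-*ʳ zero    a f = ≈-refl
  sumV-*ʳ (suc k) a f = ≈-trans (distribʳ a _ _) (+-cong (sumV-*ʳ k a _) (sumV-*ʳ k a _))

  sumV-zero : ∀ k → sumV k (λ _ → 0#) ≈ 0#
  sumV-zero zero    = ≈-refl
  sumV-zero (suc k) = ≈-trans (+-cong (sumV-zero k) (sumV-zero k)) (+-identityˡ 0#)

  sumV-++ : ∀ m n (f : Vec Bool (m + n) → Carrier) →
            sumV (m + n) f ≈ sumV m (λ x → sumV n (λ y → f (x ++ᵥ y)))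
  sumV-++ zero    n f = ≈-refl
  sumV-++ (suc m) n f = +-cong (sumV-++ m n _) (sumV-++ m n _)

  δ-sum : ∀ k (x : Vec Bool k) (f : Vec Bool k → Carrier) → sumV k (λ z → δ x z *ₖ f z) ≈ f x
  δ-sum zero    []          f = *-identityˡ _
  δ-sum (suc k) (false ∷ x) f = begin
    sumV k (λ z → δ x z *ₖ f (false ∷ z)) +ₖ sumV k (λ z → 0# *ₖ f (true ∷ z))
      ≈⟨ +-cong (δ-sum k x _) (≈-trans (sumV-cong k (λ z → zeroˡ _)) (sumV-zero k)) ⟩
    f (false ∷ x) +ₖ 0#  ≈⟨ +-identityʳ _ ⟩
    f (false ∷ x)        ∎
  δ-sum (suc k) (true ∷ x) f = begin
    sumV k (λ z → 0# *ₖ f (false ∷ z)) +ₖ sumV k (λ z → δ x z *ₖ f (true ∷ z))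
      ≈⟨ +-cong (≈-trans (sumV-cong k (λ z → zeroˡ _)) (sumV-zero k)) (δ-sum k x _) ⟩
    0# +ₖ f (true ∷ x)  ≈⟨ +-identityˡ _ ⟩
    f (true ∷ x)        ∎

  δ-sym : ∀ {k} (x y : Vec Bool k) → δ x y ≡ δ y x
  δ-sym []          []          = refl
  δ-sym (false ∷ x) (false ∷ y) = δ-sym x y
  δ-sym (false ∷ x) (true ∷ y)  = refl
  δ-sym (true ∷ x)  (false ∷ y) = refl
  δ-sym (true ∷ x)  (true ∷ y)  = δ-sym x y

  conj-0 : conj 0# ≈ 0#
  conj-0 = identityʳ-unique (conj 0#) (conj 0#)
             (≈-trans (≈-sym (conj-+ 0# 0#)) (conj-cong (+-identityˡ 0#)))

  conj-δ : ∀ {k} (x y : Vec Bool k) → conj (δ x y) ≈ δ x y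
  conj-δ []          []          = conj-1
  conj-δ (false ∷ x) (false ∷ y) = conj-δ x y
  conj-δ (false ∷ x) (true ∷ y)  = conj-0
  conj-δ (true ∷ x)  (false ∷ y) = conj-0
  conj-δ (true ∷ x)  (true ∷ y)  = conj-δ x y

  δ-++ : ∀ {m n} (x x' : Vec Bool m) (y y' : Vec Bool n) → δ (x ++ᵥ y) (x' ++ᵥ y') ≈ δ x x' *ₖ δ y y'
  δ-++ []          []           y y' = ≈-sym (*-identityˡ _)
  δ-++ (false ∷ x) (false ∷ x') y y' = δ-++ x x' y y'
  δ-++ (false ∷ x) (true ∷ x')  y y' = ≈-sym (zeroˡ _)
  δ-++ (true ∷ x)  (false ∷ x') y y' = ≈-sym (zeroˡ _)
  δ-++ (true ∷ x)  (true ∷ x')  y y' = δ-++ x x' y y'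

  infix 4 _≈ₘ_
  _≈ₘ_ : ∀ {k} → Matrix k → Matrix k → Set ℓ
  M ≈ₘ N = ∀ x y → M x y ≈ N x y

  ≈ₘ-trans : ∀ {k} {M N L : Matrix k} → M ≈ₘ N → N ≈ₘ L → M ≈ₘ L
  ≈ₘ-trans p q x y = ≈-trans (p x y) (q x y)

  ·-cong : ∀ {k} {M M' N N' : Matrix k} → M ≈ₘ M' → N ≈ₘ N' → (M ·ₘ N) ≈ₘ (M' ·ₘ N')
  ·-cong {k} p q x y = sumV-cong k (λ z → *-cong (p x z) (q z y))

  take-++ : ∀ {m n} (x : Vec Bool m) (y : Vec Bool n) → take m (x ++ᵥ y) ≡ x
  take-++ {m} x y = ++-injectiveˡ _ x (take++drop≡id m (x ++ᵥ y))

  drop-++ : ∀ {m n} (x : Vec Bool m) (y : Vec Bool n) → drop m (x ++ᵥ y) ≡ y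
  drop-++ {m} x y = ++-injectiveʳ _ x (take++drop≡id m (x ++ᵥ y))

  infixr 7 _⊠_
  _⊠_ : ∀ {m n} → Matrix m → Matrix n → Matrix (m + n)
  _⊠_ {m} M N v w = M (take m v) (take m w) *ₖ N (drop m v) (drop m w)

  ⊠-cong : ∀ {m n} {M M' : Matrix m} {N N' : Matrix n} → M ≈ₘ M' → N ≈ₘ N' → (M ⊠ N) ≈ₘ (M' ⊠ N')
  ⊠-cong p q v w = *-cong (p _ _) (q _ _)

  adj-⊠ : ∀ {m n} (M : Matrix m) (N : Matrix n) → adj (M ⊠ N) ≈ₘ (adj M ⊠ adj N)
  adj-⊠ M N v w = conj-* _ _

  ⊠-mixed : ∀ {m n} (M M' : Matrix m) (N N' : Matrix n) → ((M ⊠ N) ·ₘ (M' ⊠ N')) ≈ₘ ((M ·ₘ M') ⊠ (N ·ₘ N'))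
  ⊠-mixed {m} {n} M M' N N' v w = begin
    sumV (m + n) (λ u → (M v₁ (take m u) *ₖ N v₂ (drop m u)) *ₖ (M' (take m u) w₁ *ₖ N' (drop m u) w₂))
      ≈⟨ sumV-++ m n _ ⟩
    sumV m (λ x → sumV n (λ y → (M v₁ (take m (x ++ᵥ y)) *ₖ N v₂ (drop m (x ++ᵥ y)))
                                *ₖ (M' (take m (x ++ᵥ y)) w₁ *ₖ N' (drop m (x ++ᵥ y)) w₂)))
      ≈⟨ sumV-cong m (λ x → sumV-cong n (λ y → regroup x y)) ⟩
    sumV m (λ x → sumV n (λ y → (M v₁ x *ₖ M' x w₁) *ₖ (N v₂ y *ₖ N' y w₂)))
      ≈⟨ sumV-cong m (λ x → ≈-sym (sumV-*ˡ n _ _)) ⟩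
    sumV m (λ x → (M v₁ x *ₖ M' x w₁) *ₖ sumV n (λ y → N v₂ y *ₖ N' y w₂))
      ≈⟨ ≈-sym (sumV-*ʳ m _ _) ⟩
    sumV m (λ x → M v₁ x *ₖ M' x w₁) *ₖ sumV n (λ y → N v₂ y *ₖ N' y w₂) ∎
    where
    v₁ = take m v
    v₂ = drop m v
    w₁ = take m w
    w₂ = drop m w
    regroup : ∀ x y → (M v₁ (take m (x ++ᵥ y)) *ₖ N v₂ (drop m (x ++ᵥ y)))
                      *ₖ (M' (take m (x ++ᵥ y)) w₁ *ₖ N' (drop m (x ++ᵥ y)) w₂)
                    ≈ (M v₁ x *ₖ M' x w₁) *ₖ (N v₂ y *ₖ N' y w₂)
    regroup x y rewrite take-++ x y | drop-++ x y = interchange _ _ _ _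

  δ-⊠ : ∀ {m n} → (δ {m} ⊠ δ {n}) ≈ₘ δ {m + n}
  δ-⊠ {m} v w = begin
    δ (take m v) (take m w) *ₖ δ (drop m v) (drop m w)
      ≈⟨ ≈-sym (δ-++ (take m v) (take m w) (drop m v) (drop m w)) ⟩
    δ (take m v ++ᵥ drop m v) (take m w ++ᵥ drop m w)
      ≡⟨ cong₂ δ (take++drop≡id m v) (take++drop≡id m w) ⟩
    δ v w ∎

  ⊠-unitary : ∀ {m n} {M : Matrix m} {N : Matrix n} → IsUnitary M → IsUnitary N → IsUnitary (M ⊠ N)
  ⊠-unitary {m} {n} {M} {N} (M*M≈I , MM*≈I) (N*N≈I , NN*≈I) =
    ≈ₘ-trans (·-cong (adj-⊠ M N) (λ _ _ → ≈-refl))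
      (≈ₘ-trans (⊠-mixed (adj M) M (adj N) N) (≈ₘ-trans (⊠-cong M*M≈I N*N≈I) (δ-⊠ {m} {n}))) ,
    ≈ₘ-trans (·-cong (λ _ _ → ≈-refl) (adj-⊠ M N))
      (≈ₘ-trans (⊠-mixed M (adj M) N (adj N)) (≈ₘ-trans (⊠-cong MM*≈I NN*≈I) (δ-⊠ {m} {n})))

  δ-unitary : ∀ k → IsUnitary (δ {k})
  δ-unitary k = (λ x y → ≈-trans (sumV-cong k (λ z → *-cong (δ-real z x) ≈-refl)) (δ-sum k x (λ z → δ z y))) ,
                (λ x y → ≈-trans (sumV-cong k (λ z → *-cong ≈-refl (δ-real y z))) (δ-sum k x (λ z → δ z y)))
    where
    δ-real : ∀ (x y : Vec Bool k) → conj (δ x y) ≈ δ y x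
    δ-real x y = ≈-trans (conj-δ x y) (≈-reflexive (δ-sym x y))

  adj-unitary : ∀ {k} {M : Matrix k} → IsUnitary M → IsUnitary (adj M)
  adj-unitary (M*M≈I , MM*≈I) =
    ≈ₘ-trans (·-cong (λ _ _ → conj-invol _) (λ _ _ → ≈-refl)) MM*≈I ,
    ≈ₘ-trans (·-cong (λ _ _ → ≈-refl) (λ _ _ → conj-invol _)) M*M≈I

  idU : ∀ k → Unitary k
  idU k = δ , δ-unitary k

  adjU : ∀ {k} → Unitary k → Unitary k
  adjU (M , u) = adj M , adj-unitary u

  embedU : ∀ a b {n} → Unitary n → Unitary ((a + n) + b)
  embedU a b (M , u) = (δ {a} ⊠ M) ⊠ δ {b} , ⊠-unitary (⊠-unitary (δ-unitary a) u) (δ-unitary b)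

  -- The register operation kron of the quantum rule is application of
  -- embedU: summing a row of (δ ⊠ M) ⊠ δ against Q at the basis vector
  -- (x ++ y) ++ z only leaves the middle block free.

  embed-row : ∀ a b {n} (M : Matrix n) (Q : Reg ((a + n) + b)) x y z →
    sumV ((a + n) + b) (λ w → ((δ x (take a (take (a + n) w)) *ₖ M y (drop a (take (a + n) w)))
                                *ₖ δ z (drop (a + n) w)) *ₖ Q w)
    ≈ sumV n (λ y' → M y y' *ₖ Q ((x ++ᵥ y') ++ᵥ z))
  embed-row a b {n} M Q x y z = begin
    sumV ((a + n) + b) (λ w → row w *ₖ Q w)
      ≈⟨ sumV-++ (a + n) b _ ⟩
    sumV (a + n) (λ u → sumV b (λ z' → row (u ++ᵥ z') *ₖ Q (u ++ᵥ z')))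
      ≈⟨ sumV-cong (a + n) (λ u → sumV-cong b (λ z' → outer u z')) ⟩
    sumV (a + n) (λ u → sumV b (λ z' → δ z z' *ₖ (inner u *ₖ Q (u ++ᵥ z'))))
      ≈⟨ sumV-cong (a + n) (λ u → δ-sum b z _) ⟩
    sumV (a + n) (λ u → inner u *ₖ Q (u ++ᵥ z))
      ≈⟨ sumV-++ a n _ ⟩
    sumV a (λ x' → sumV n (λ y' → inner (x' ++ᵥ y') *ₖ Q ((x' ++ᵥ y') ++ᵥ z)))
      ≈⟨ sumV-cong a (λ x' → sumV-cong n (λ y' → middle x' y')) ⟩
    sumV a (λ x' → sumV n (λ y' → δ x x' *ₖ (M y y' *ₖ Q ((x' ++ᵥ y') ++ᵥ z))))
      ≈⟨ sumV-cong a (λ x' → ≈-sym (sumV-*ˡ n _ _)) ⟩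
    sumV a (λ x' → δ x x' *ₖ sumV n (λ y' → M y y' *ₖ Q ((x' ++ᵥ y') ++ᵥ z)))
      ≈⟨ δ-sum a x _ ⟩
    sumV n (λ y' → M y y' *ₖ Q ((x ++ᵥ y') ++ᵥ z)) ∎
    where
    inner : Vec Bool (a + n) → Carrier
    inner u = δ x (take a u) *ₖ M y (drop a u)
    row : Vec Bool ((a + n) + b) → Carrier
    row w = inner (take (a + n) w) *ₖ δ z (drop (a + n) w)
    outer : ∀ u z' → row (u ++ᵥ z') *ₖ Q (u ++ᵥ z') ≈ δ z z' *ₖ (inner u *ₖ Q (u ++ᵥ z'))
    outer u z' rewrite take-++ u z' | drop-++ u z' = ≈-trans (*-cong (*-comm _ _) ≈-refl) (*-assoc _ _ _)
    middle : ∀ x' y' → inner (x' ++ᵥ y') *ₖ Q ((x' ++ᵥ y') ++ᵥ z) ≈ δ x x' *ₖ (M y y' *ₖ Q ((x' ++ᵥ y') ++ᵥ z))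
    middle x' y' rewrite take-++ x' y' | drop-++ x' y' = *-assoc _ _ _

  apply-embed : ∀ a b {n} (U : Unitary n) (Q : Reg ((a + n) + b)) v →
    applyU (embedU a b U) Q v ≈ kron a n b (proj₁ U) Q v
  apply-embed a b {n} U Q v with splitAt (a + n) v
  ... | xy , z , refl with splitAt a xy
  ...   | x , y , refl = embed-row a b (proj₁ U) Q x y z

  regEq-cast : ∀ {k j} (e : k ≡ j) (Q : Reg k) → RegEq (castR e Q) (applyU (idU k) Q)
  regEq-cast refl Q = refl , λ v → ≈-sym (δ-sum _ v Q)

  regEq-embed : ∀ {k j} a b {n} (U : Unitary n) (e e' : k ≡ (a + n) + b) (e'' : (a + n) + b ≡ j) (Q : Reg k) →
    RegEq (castR e'' (kron a n b (proj₁ U) (castR e' Q))) (applyU (subst Unitary (sym e) (embedU a b U)) Q)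
  regEq-embed a b U e e' e'' Q rewrite ≡-irrelevant e' e = embedded e e'' Q
    where
    embedded : ∀ {k j} (e : k ≡ (a + _) + b) (e'' : (a + _) + b ≡ j) (Q : Reg k) →
      RegEq (castR e'' (kron a _ b (proj₁ U) (castR e Q))) (applyU (subst Unitary (sym e) (embedU a b U)) Q)
    embedded refl refl Q = refl , λ v → ≈-sym (apply-embed a b U Q v)

module Syntax where
  open import Algebra.Properties.Monoid.Divisibility (++-monoid Mod) using (_∣ʳ_) renaming (_,_ to divides)

  -- Plugging a context is injective in the plugged formula, so no context
  -- is both positive and negative for the same formula.

  private
    left right body : Formula → Formula
    left (A ⅋ _) = A
    left (A ⊗ _) = A
    left F       = F
    right (_ ⅋ B) = B
    right (_ ⊗ B) = B
    right F       = F
    body (⊡ A) = A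
    body (◇ A) = A
    body F     = F

  plug-injective : ∀ C {X Y} → plug C X ≡ plug C Y → X ≡ Y
  plug-injective hole     e = e
  plug-injective (C ⅋ₗ _) e = plug-injective C (cong left e)
  plug-injective (_ ⅋ᵣ C) e = plug-injective C (cong right e)
  plug-injective (C ⊗ₗ _) e = plug-injective C (cong left e)
  plug-injective (_ ⊗ᵣ C) e = plug-injective C (cong right e)
  plug-injective (⊡c C)   e = plug-injective C (cong body e)
  plug-injective (◇c C)   e = plug-injective C (cong body e)

  pos≢neg : ∀ {C X} → PosCtx C X → NegCtx C X → ⊥
  pos≢neg {C} (_ , e) (_ , e') with plug-injective C (trans e (sym e'))
  ... | ()

  plug-◇c^ : ∀ n N X → plug (◇c^ n N) X ≡ ◇^ n (plug N X)
  plug-◇c^ zero    N X = refl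
  plug-◇c^ (suc n) N X = cong ◇ (plug-◇c^ n N X)

  plug-⊡c^ : ∀ n N X → plug (⊡c^ n N) X ≡ ⊡^ n (plug N X)
  plug-⊡c^ zero    N X = refl
  plug-⊡c^ (suc n) N X = cong ⊡ (plug-⊡c^ n N X)

  -- Removing n outermost modalities of a context, when they are there;
  -- this is how the conclusion ◇ⁿA of a quantum rule is entered.

  unwrap◇ : ℕ → Ctx → Maybe Ctx
  unwrap◇ zero    C      = just C
  unwrap◇ (suc n) (◇c C) = unwrap◇ n C
  unwrap◇ (suc n) _      = nothing

  unwrap⊡ : ℕ → Ctx → Maybe Ctx
  unwrap⊡ zero    C      = just C
  unwrap⊡ (suc n) (⊡c C) = unwrap⊡ n C
  unwrap⊡ (suc n) _      = nothing

  unwrap◇-◇c^ : ∀ n N → unwrap◇ n (◇c^ n N) ≡ just N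
  unwrap◇-◇c^ zero    N = refl
  unwrap◇-◇c^ (suc n) N = unwrap◇-◇c^ n N

  unwrap⊡-⊡c^ : ∀ n N → unwrap⊡ n (⊡c^ n N) ≡ just N
  unwrap⊡-⊡c^ zero    N = refl
  unwrap⊡-⊡c^ (suc n) N = unwrap⊡-⊡c^ n N

  _≟ᴹ_ : DecidableEquality Mod
  m⊡ ≟ᴹ m⊡ = yes refl
  m⊡ ≟ᴹ m◇ = no λ ()
  m◇ ≟ᴹ m⊡ = no λ ()
  m◇ ≟ᴹ m◇ = yes refl

  replicate-∷ʳ : ∀ n (m : Mod) → m ∷ replicate n m ≡ replicate n m ∷ʳ m
  replicate-∷ʳ zero    m = refl
  replicate-∷ʳ (suc n) m = cong (m ∷_) (replicate-∷ʳ n m)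

  ++-replicate-suc : ∀ (s : Stack) n m → s ++ₗ replicate (suc n) m ≡ (s ++ₗ replicate n m) ∷ʳ m
  ++-replicate-suc s n m = trans (cong (s ++ₗ_) (replicate-∷ʳ n m)) (sym (++-assoc s (replicate n m) (m ∷ [])))

  block-injective : ∀ {n} → 1 ≤ n → ∀ {s s' : Stack} {m m' : Mod} →
    s ++ₗ replicate n m ≡ s' ++ₗ replicate n m' → s ≡ s' × m ≡ m'
  block-injective {suc n} _ {s} {s'} {m} {m'} e
    with ∷ʳ-injective (s ++ₗ replicate n m) (s' ++ₗ replicate n m')
           (trans (sym (++-replicate-suc s n m)) (trans e (++-replicate-suc s' n m')))
  ... | e' , refl = ++-cancelʳ (replicate n m) s s' e' , refl

  data Top (n : ℕ) (t : Stack) : Set where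
    block : (s : Stack) (m : Mod) → s ++ₗ replicate n m ≡ t → Top n t
    none  : (∀ s m → s ++ₗ replicate n m ≡ t → ⊥) → Top n t

  ends? : ∀ n m t → Dec (replicate n m ∣ʳ t)
  ends? n m t = Dec.map′ Suffix-as-∣ʳ ∣ʳ-as-Suffix (suffix? _≟ᴹ_ (replicate n m) t)

  top? : ∀ n t → Top n t
  top? n t with ends? n m◇ t | ends? n m⊡ t
  ... | yes (divides s e) | _                 = block s m◇ e
  ... | no _              | yes (divides s e) = block s m⊡ e
  ... | no ¬◇             | no ¬⊡             = none λ where
    s m◇ e → ¬◇ (divides s e)
    s m⊡ e → ¬⊡ (divides s e)

module Transitions {c ℓ : Level} (K : StarCommRing c ℓ) where
  open QMLL K
  open LinearAlgebra K
  open Syntax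

  record Outcome {Γ} (π : Proof Γ) (k : ℕ) : Set (c ⊔ ℓ) where
    constructor outcome
    field
      occ : Occ π
      ctx : Ctx
      stk : Stack
      op  : Unitary k

  plain : ∀ {Γ} {π : Proof Γ} {k} → Occ π → Ctx → Stack → Outcome π k
  plain B D r = outcome B D r (idU _)

  mapOutcome : ∀ {Γ₁ Γ} {π₁ : Proof Γ₁} {π : Proof Γ} {k} → (Occ π₁ → Occ π) → Outcome π₁ k → Outcome π k
  mapOutcome f (outcome B D r U) = outcome (f B) D r U

  Match : ∀ {Γ} {π : Proof Γ} {k} → State π → Outcome π k → Reg k → Set (c ⊔ ℓ)
  Match T o Q = (State.occ T ≡ Outcome.occ o) × (State.ctx T ≡ Outcome.ctx o) × (State.stk T ≡ Outcome.stk o)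
              × RegEq (State.reg T) (applyU (Outcome.op o) Q)

  Sound : ∀ {Γ} (π : Proof Γ) (A : Occ π) (C : Ctx) (s : Stack) → Outcome π (d C + length s) → Set (c ⊔ ℓ)
  Sound π A C s o = ∀ Q T → Step π ⟨ A , C , s , Q ⟩ T → Match T o Q

  Determined : ∀ {Γ} (π : Proof Γ) (A : Occ π) (C : Ctx) (s : Stack) → Set (c ⊔ ℓ)
  Determined π A C s = Σ (Outcome π (d C + length s)) (Sound π A C s)

  plain-match : ∀ {Γ} {π : Proof Γ} {B : Occ π} {D r k} (e : k ≡ d D + length r) (Q : Reg k) →
    Match ⟨ B , D , r , castR e Q ⟩ (plain B D r) Q
  plain-match e Q = refl , refl , refl , regEq-cast e Q

  lift-match : ∀ {Γ₁ Γ} {π₁ : Proof Γ₁} {π : Proof Γ} {k} (f : Occ π₁ → Occ π) (o : Outcome π₁ k) {T : State π₁} {Q} →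
    Match T o Q → Match (lift f T) (mapOutcome f o) Q
  lift-match f _ (e₁ , e₂ , e₃ , e₄) = cong f e₁ , e₂ , e₃ , e₄

  canon : ∀ {Σ' Γ} {X : Formula} → Σ' ↭ Γ → X ∈ Σ' → X ∈ Γ
  canon ρ = ∈-resp-↭ ρ

  canon-fr : ∀ {Σ' Γ} {X : Formula} (ρ : Σ' ↭ Γ) (y : X ∈ Γ) → canon ρ (fr ρ y) ≡ y
  canon-fr = ∈-resp-[σ∘σ⁻¹]

  upward-negative : ∀ {Γ} {π : Proof Γ} {X} {x : X ∈ Γ} {C s Q T} → Step π ⟨ oroot x , C , s , Q ⟩ T → NegCtx C X
  upward-negative (root (ax-A nc))              = nc
  upward-negative (root (ax-A⊥ nc))             = nc
  upward-negative (root (cut-upΓ _ nc))         = nc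
  upward-negative (root (cut-upΔ _ nc))         = nc
  upward-negative (root (par-upA (α , e)))      = α , cong (_⅋ _) e
  upward-negative (root (par-upB (α , e)))      = α , cong (_ ⅋_) e
  upward-negative (root (par-up _ nc))          = nc
  upward-negative (root (ten-upA (α , e)))      = α , cong (_⊗ _) e
  upward-negative (root (ten-upB (α , e)))      = α , cong (_ ⊗_) e
  upward-negative (root (ten-upΓ _ nc))         = nc
  upward-negative (root (ten-upΔ _ nc))         = nc
  upward-negative (root (q-upA {n = n} {N = N} (α , e))) = α , trans (plug-◇c^ n N _) (cong (◇^ n) e)
  upward-negative (root (q-upB {n = n} {N = N} (α , e))) = α , trans (plug-⊡c^ n N _) (cong (⊡^ n) e)

  positive-stuck : ∀ {Γ} {π : Proof Γ} {X} {x : X ∈ Γ} {C s Q T} → Step π ⟨ oroot x , C , s , Q ⟩ T → PosCtx C X → ⊥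
  positive-stuck st pc = pos≢neg pc (upward-negative st)

  -- Occurrences of a premise: conclusions with a positive context leave the
  -- premise downwards; all other states of the premise are handled inside it.
  PosRoot : ∀ {Γ} {π : Proof Γ} → Occ π → Ctx → Set
  PosRoot (oroot {X = X} _) C = PosCtx C X
  PosRoot _                 _ = ⊥

  data RootView {Γ} {π : Proof Γ} (C : Ctx) : Occ π → Set (c ⊔ ℓ) where
    positive-root : ∀ {X} (y : X ∈ Γ) → PosCtx C X → RootView C (oroot y)
    inner         : ∀ {o} → ¬ PosRoot o C → RootView C o

  rootView : ∀ {Γ} {π : Proof Γ} (o : Occ π) {C} → CtxFor C (occF o) → RootView C o
  rootView (oroot y) (inj₁ pc) = positive-root y pc
  rootView (oroot y) (inj₂ nc) = inner (λ pc → pos≢neg pc nc)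
  rootView (ocut₁ _) _ = inner λ ()
  rootView (ocut₂ _) _ = inner λ ()
  rootView (opar _)  _ = inner λ ()
  rootView (oten₁ _) _ = inner λ ()
  rootView (oten₂ _) _ = inner λ ()
  rootView (oq _)    _ = inner λ ()

  descend : ∀ {Γ₁ Γ} {π₁ : Proof Γ₁} {π : Proof Γ} (emb : Occ π₁ → Occ π) →
    (∀ {o C s} (out : Outcome π₁ (d C + length s)) → ¬ PosRoot o C → Sound π₁ o C s out →
       Sound π (emb o) C s (mapOutcome emb out)) →
    (∀ {X} (y : X ∈ Γ₁) {C s} → PosCtx C X → Determined π (emb (oroot y)) C s) →
    ∀ (o : Occ π₁) {C s} → CtxFor C (occF o) → Determined π₁ o C s → Determined π (emb o) C s
  descend emb lift-sound down o hc (out , sound) with rootView o hc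
  ... | positive-root y pc = down y pc
  ... | inner np           = mapOutcome emb out , lift-sound out np sound

  module AxiomRule {Σ'} (A : Formula) (ρ : Σ' ↭ ((A ^⊥) ∷ A ∷ [])) where
    up : ∀ {X} → X ∈ ((A ^⊥) ∷ A ∷ []) → ∀ C s → Outcome (ax A ρ) (d C + length s)
    up (here _)  C s = plain (oroot (fr ρ (there (here refl)))) (dualC C) s
    up (there _) C s = plain (oroot (fr ρ (here refl))) (dualC C) s

    up-sound : ∀ {X} (x : X ∈ Σ') C s → Sound (ax A ρ) (oroot x) C s (up (canon ρ x) C s)
    up-sound _ _ _ Q _ (root (ax-A _))  rewrite canon-fr ρ (there (here refl)) = plain-match _ Q
    up-sound _ _ _ Q _ (root (ax-A⊥ _)) rewrite canon-fr ρ (here refl)         = plain-match _ Q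

    root-determined : ∀ {X} (x : X ∈ Σ') C s → Determined (ax A ρ) (oroot x) C s
    root-determined x C s = up (canon ρ x) C s , up-sound x C s

  module CutRule {Σ' Γ Δ} (A : Formula) (π₁ : Proof (A ∷ Γ)) (π₂ : Proof ((A ^⊥) ∷ Δ))
                 (ρ : Σ' ↭ (Γ ++ₗ Δ)) where
    up : ∀ {X} → X ∈ (Γ ++ₗ Δ) → ∀ C s → Outcome (cut A π₁ π₂ ρ) (d C + length s)
    up y C s = [ (λ q → plain (ocut₁ (oroot (there q))) C s) , (λ q → plain (ocut₂ (oroot (there q))) C s) ]′
                 (++⁻ Γ y)

    up-sound : ∀ {X} (x : X ∈ Σ') C s → Sound (cut A π₁ π₂ ρ) (oroot x) C s (up (canon ρ x) C s)
    up-sound _ _ _ Q _ (root (cut-upΓ q _)) rewrite canon-fr ρ (++⁺ˡ q)   | ++⁻∘++⁺ Γ {Δ} (inj₁ q) = plain-match refl Q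
    up-sound _ _ _ Q _ (root (cut-upΔ q _)) rewrite canon-fr ρ (++⁺ʳ Γ q) | ++⁻∘++⁺ Γ {Δ} (inj₂ q) = plain-match refl Q

    root-determined : ∀ {X} (x : X ∈ Σ') C s → Determined (cut A π₁ π₂ ρ) (oroot x) C s
    root-determined x C s = up (canon ρ x) C s , up-sound x C s

    down₁ : ∀ {X} (y : X ∈ (A ∷ Γ)) {C s} → PosCtx C X → Determined (cut A π₁ π₂ ρ) (ocut₁ (oroot y)) C s
    down₁ (here refl) {C} {s} pc = plain (ocut₂ (oroot (here refl))) (dualC C) s , λ where
      Q _ (cut₁ st)         → ⊥-elim (positive-stuck st pc)
      Q _ (root (cut-A _)) → plain-match _ Q
    down₁ (there q) {C} {s} pc = plain (oroot (fr ρ (++⁺ˡ q))) C s , λ where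
      Q _ (cut₁ st)               → ⊥-elim (positive-stuck st pc)
      Q _ (root (cut-downΓ _ _)) → plain-match refl Q

    down₂ : ∀ {X} (y : X ∈ ((A ^⊥) ∷ Δ)) {C s} → PosCtx C X → Determined (cut A π₁ π₂ ρ) (ocut₂ (oroot y)) C s
    down₂ (here refl) {C} {s} pc = plain (ocut₁ (oroot (here refl))) (dualC C) s , λ where
      Q _ (cut₂ st)          → ⊥-elim (positive-stuck st pc)
      Q _ (root (cut-A⊥ _)) → plain-match _ Q
    down₂ (there q) {C} {s} pc = plain (oroot (fr ρ (++⁺ʳ Γ q))) C s , λ where
      Q _ (cut₂ st)               → ⊥-elim (positive-stuck st pc)
      Q _ (root (cut-downΔ _ _)) → plain-match refl Q

    lift₁ : ∀ {o C s} (out : Outcome π₁ (d C + length s)) → ¬ PosRoot o C → Sound π₁ o C s out →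
            Sound (cut A π₁ π₂ ρ) (ocut₁ o) C s (mapOutcome ocut₁ out)
    lift₁ out _ sound Q _ (cut₁ st) = lift-match ocut₁ out (sound Q _ st)
    lift₁ _ np _     Q _ (root (cut-A pc))       = ⊥-elim (np pc)
    lift₁ _ np _     Q _ (root (cut-downΓ _ pc)) = ⊥-elim (np pc)

    lift₂ : ∀ {o C s} (out : Outcome π₂ (d C + length s)) → ¬ PosRoot o C → Sound π₂ o C s out →
            Sound (cut A π₁ π₂ ρ) (ocut₂ o) C s (mapOutcome ocut₂ out)
    lift₂ out _ sound Q _ (cut₂ st) = lift-match ocut₂ out (sound Q _ st)
    lift₂ _ np _     Q _ (root (cut-A⊥ pc))      = ⊥-elim (np pc)
    lift₂ _ np _     Q _ (root (cut-downΔ _ pc)) = ⊥-elim (np pc)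

  -- The last clause of 'up' covers the states without a transition.
  module ParRule {Σ' Γ} (A B : Formula) (π₁ : Proof (A ∷ B ∷ Γ)) (ρ : Σ' ↭ ((A ⅋ B) ∷ Γ)) where
    up : ∀ {X} → X ∈ ((A ⅋ B) ∷ Γ) → ∀ C s → Outcome (par A B π₁ ρ) (d C + length s)
    up (here _)  (N ⅋ₗ _) s = plain (opar (oroot (here refl))) N s
    up (here _)  (_ ⅋ᵣ N) s = plain (opar (oroot (there (here refl)))) N s
    up (there q) C        s = plain (opar (oroot (there (there q)))) C s
    up y         C        s = plain (oroot (fr ρ y)) C s

    up-sound : ∀ {X} (x : X ∈ Σ') C s → Sound (par A B π₁ ρ) (oroot x) C s (up (canon ρ x) C s)
    up-sound _ _ _ Q _ (root (par-upA _))  rewrite canon-fr ρ (here refl)  = plain-match refl Q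
    up-sound _ _ _ Q _ (root (par-upB _))  rewrite canon-fr ρ (here refl)  = plain-match refl Q
    up-sound _ _ _ Q _ (root (par-up q _)) rewrite canon-fr ρ (there q)    = plain-match refl Q

    root-determined : ∀ {X} (x : X ∈ Σ') C s → Determined (par A B π₁ ρ) (oroot x) C s
    root-determined x C s = up (canon ρ x) C s , up-sound x C s

    down : ∀ {X} (y : X ∈ (A ∷ B ∷ Γ)) {C s} → PosCtx C X → Determined (par A B π₁ ρ) (opar (oroot y)) C s
    down (here refl) {C} {s} pc = plain (oroot (fr ρ (here refl))) (C ⅋ₗ B) s , λ where
      Q _ (par₁ st)              → ⊥-elim (positive-stuck st pc)
      Q _ (root (par-downA _)) → plain-match refl Q
    down (there (here refl)) {C} {s} pc = plain (oroot (fr ρ (here refl))) (A ⅋ᵣ C) s , λ where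
      Q _ (par₁ st)              → ⊥-elim (positive-stuck st pc)
      Q _ (root (par-downB _)) → plain-match refl Q
    down (there (there q)) {C} {s} pc = plain (oroot (fr ρ (there q))) C s , λ where
      Q _ (par₁ st)                → ⊥-elim (positive-stuck st pc)
      Q _ (root (par-down _ _)) → plain-match refl Q

    lift₁ : ∀ {o C s} (out : Outcome π₁ (d C + length s)) → ¬ PosRoot o C → Sound π₁ o C s out →
           Sound (par A B π₁ ρ) (opar o) C s (mapOutcome opar out)
    lift₁ out _ sound Q _ (par₁ st) = lift-match opar out (sound Q _ st)
    lift₁ _ np _ Q _ (root (par-downA pc))   = ⊥-elim (np pc)
    lift₁ _ np _ Q _ (root (par-downB pc))   = ⊥-elim (np pc)
    lift₁ _ np _ Q _ (root (par-down _ pc))  = ⊥-elim (np pc)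

  module TensorRule {Σ' Γ Δ} (A B : Formula) (π₁ : Proof (A ∷ Γ)) (π₂ : Proof (B ∷ Δ))
                    (ρ : Σ' ↭ ((A ⊗ B) ∷ Γ ++ₗ Δ)) where
    up : ∀ {X} → X ∈ ((A ⊗ B) ∷ Γ ++ₗ Δ) → ∀ C s → Outcome (ten A B π₁ π₂ ρ) (d C + length s)
    up (here _)  (N ⊗ₗ _) s = plain (oten₁ (oroot (here refl))) N s
    up (here _)  (_ ⊗ᵣ N) s = plain (oten₂ (oroot (here refl))) N s
    up (there y) C        s = [ (λ q → plain (oten₁ (oroot (there q))) C s) , (λ q → plain (oten₂ (oroot (there q))) C s) ]′
                                (++⁻ Γ y)
    up y         C        s = plain (oroot (fr ρ y)) C s

    up-sound : ∀ {X} (x : X ∈ Σ') C s → Sound (ten A B π₁ π₂ ρ) (oroot x) C s (up (canon ρ x) C s)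
    up-sound _ _ _ Q _ (root (ten-upA _))   rewrite canon-fr ρ (here refl) = plain-match refl Q
    up-sound _ _ _ Q _ (root (ten-upB _))   rewrite canon-fr ρ (here refl) = plain-match refl Q
    up-sound _ _ _ Q _ (root (ten-upΓ q _)) rewrite canon-fr ρ (there (++⁺ˡ q))   | ++⁻∘++⁺ Γ {Δ} (inj₁ q) = plain-match refl Q
    up-sound _ _ _ Q _ (root (ten-upΔ q _)) rewrite canon-fr ρ (there (++⁺ʳ Γ q)) | ++⁻∘++⁺ Γ {Δ} (inj₂ q) = plain-match refl Q

    root-determined : ∀ {X} (x : X ∈ Σ') C s → Determined (ten A B π₁ π₂ ρ) (oroot x) C s
    root-determined x C s = up (canon ρ x) C s , up-sound x C s

    down₁ : ∀ {X} (y : X ∈ (A ∷ Γ)) {C s} → PosCtx C X → Determined (ten A B π₁ π₂ ρ) (oten₁ (oroot y)) C s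
    down₁ (here refl) {C} {s} pc = plain (oroot (fr ρ (here refl))) (C ⊗ₗ B) s , λ where
      Q _ (ten₁ st)              → ⊥-elim (positive-stuck st pc)
      Q _ (root (ten-downA _)) → plain-match refl Q
    down₁ (there q) {C} {s} pc = plain (oroot (fr ρ (there (++⁺ˡ q)))) C s , λ where
      Q _ (ten₁ st)                → ⊥-elim (positive-stuck st pc)
      Q _ (root (ten-downΓ _ _)) → plain-match refl Q

    down₂ : ∀ {X} (y : X ∈ (B ∷ Δ)) {C s} → PosCtx C X → Determined (ten A B π₁ π₂ ρ) (oten₂ (oroot y)) C s
    down₂ (here refl) {C} {s} pc = plain (oroot (fr ρ (here refl))) (A ⊗ᵣ C) s , λ where
      Q _ (ten₂ st)              → ⊥-elim (positive-stuck st pc)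
      Q _ (root (ten-downB _)) → plain-match refl Q
    down₂ (there q) {C} {s} pc = plain (oroot (fr ρ (there (++⁺ʳ Γ q)))) C s , λ where
      Q _ (ten₂ st)                → ⊥-elim (positive-stuck st pc)
      Q _ (root (ten-downΔ _ _)) → plain-match refl Q

    lift₁ : ∀ {o C s} (out : Outcome π₁ (d C + length s)) → ¬ PosRoot o C → Sound π₁ o C s out →
            Sound (ten A B π₁ π₂ ρ) (oten₁ o) C s (mapOutcome oten₁ out)
    lift₁ out _ sound Q _ (ten₁ st) = lift-match oten₁ out (sound Q _ st)
    lift₁ _ np _ Q _ (root (ten-downA pc))   = ⊥-elim (np pc)
    lift₁ _ np _ Q _ (root (ten-downΓ _ pc)) = ⊥-elim (np pc)

    lift₂ : ∀ {o C s} (out : Outcome π₂ (d C + length s)) → ¬ PosRoot o C → Sound π₂ o C s out →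
            Sound (ten A B π₁ π₂ ρ) (oten₂ o) C s (mapOutcome oten₂ out)
    lift₂ out _ sound Q _ (ten₂ st) = lift-match oten₂ out (sound Q _ st)
    lift₂ _ np _ Q _ (root (ten-downB pc))   = ⊥-elim (np pc)
    lift₂ _ np _ Q _ (root (ten-downΔ _ pc)) = ⊥-elim (np pc)

  -- The unitary U acting on the block of n qubits that a quantum rule with
  -- n modalities has pushed on top of the stack s below, under a context C.
  block-size : ∀ C {n} {s : Stack} {m t} → s ++ₗ replicate n m ≡ t → d C + length t ≡ (d C + n) + length s
  block-size C {n} {s} {m} e = trans (cong (λ u → d C + length u) (sym e)) (push-eq (d C) s n m)

  onBlock : ∀ C {n} {s : Stack} {m t} → s ++ₗ replicate n m ≡ t → Unitary n → Unitary (d C + length t)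
  onBlock C {n} {s} e U = subst Unitary (sym (block-size C e)) (embedU (d C) (length s) U)

  regEq-onBlock : ∀ C {n} {s : Stack} {m j} (e : s ++ₗ replicate n m ≡ s ++ₗ replicate n m) (U : Unitary n)
    (e' : (d C + n) + length s ≡ j) (Q : Reg (d C + length (s ++ₗ replicate n m))) →
    RegEq (castR e' (kron (d C) n (length s) (proj₁ U) (castR (push-eq (d C) s n m) Q))) (applyU (onBlock C e U) Q)
  regEq-onBlock C {n} {s} {m} e U e' Q = regEq-embed (d C) (length s) U (block-size C e) (push-eq (d C) s n m) e' Q

  -- The fallback outcomes (nothing, none) cover states without a transition.
  module QuantumRule {Σ'} (n : ℕ) (A B : Formula) (h : 1 ≤ n) (k : SameKind A B) (V : Unitary n)
                     (π₁ : Proof (A ∷ B ∷ [])) (ρ : Σ' ↭ (◇^ n A ∷ ⊡^ n B ∷ [])) where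
    up : ∀ {X} → X ∈ (◇^ n A ∷ ⊡^ n B ∷ []) → ∀ C s → Outcome (qr n A B h k V π₁ ρ) (d C + length s)
    up y@(here _)  C s = maybe′ (λ N → plain (oq (oroot (here refl))) N (s ++ₗ replicate n m◇))
                                (plain (oroot (fr ρ y)) C s) (unwrap◇ n C)
    up y@(there _) C s = maybe′ (λ N → plain (oq (oroot (there (here refl)))) N (s ++ₗ replicate n m⊡))
                                (plain (oroot (fr ρ y)) C s) (unwrap⊡ n C)

    up-sound : ∀ {X} (x : X ∈ Σ') C s → Sound (qr n A B h k V π₁ ρ) (oroot x) C s (up (canon ρ x) C s)
    up-sound _ _ _ Q _ (root (q-upA {N = N} _))
      rewrite canon-fr ρ (here refl) | unwrap◇-◇c^ n N = plain-match _ Q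
    up-sound _ _ _ Q _ (root (q-upB {N = N} _))
      rewrite canon-fr ρ (there (here refl)) | unwrap⊡-⊡c^ n N = plain-match _ Q

    root-determined : ∀ {X} (x : X ∈ Σ') C s → Determined (qr n A B h k V π₁ ρ) (oroot x) C s
    root-determined x C s = up (canon ρ x) C s , up-sound x C s

    down-outcome : ∀ {X} → X ∈ (A ∷ B ∷ []) → ∀ C t → Top n t → Outcome (qr n A B h k V π₁ ρ) (d C + length t)
    down-outcome (here _)         C t (block s m◇ e) = plain (oroot (fr ρ (here refl))) (◇c^ n C) s
    down-outcome (here _)         C t (block s m⊡ e) = outcome (oroot (fr ρ (here refl))) (◇c^ n C) s (onBlock C e (adjU V))
    down-outcome (there (here _)) C t (block s m⊡ e) = plain (oroot (fr ρ (there (here refl)))) (⊡c^ n C) s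
    down-outcome (there (here _)) C t (block s m◇ e) = outcome (oroot (fr ρ (there (here refl)))) (⊡c^ n C) s (onBlock C e V)
    down-outcome y                C t (none _)       = plain (oq (oroot y)) C t

    down-sound : ∀ {X} (y : X ∈ (A ∷ B ∷ [])) C t (v : Top n t) → PosCtx C X →
                 Sound (qr n A B h k V π₁ ρ) (oq (oroot y)) C t (down-outcome y C t v)
    down-sound _ _ _ _ pc Q _ (q₁ st) = ⊥-elim (positive-stuck st pc)
    down-sound _ _ _ (none ¬b) _ Q _ (root (q-downA◇ {s = s} _)) = ⊥-elim (¬b s m◇ refl)
    down-sound _ _ _ (none ¬b) _ Q _ (root (q-downA⊡ {s = s} _)) = ⊥-elim (¬b s m⊡ refl)
    down-sound _ _ _ (none ¬b) _ Q _ (root (q-downB⊡ {s = s} _)) = ⊥-elim (¬b s m⊡ refl)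
    down-sound _ _ _ (none ¬b) _ Q _ (root (q-downB◇ {s = s} _)) = ⊥-elim (¬b s m◇ refl)
    down-sound _ _ _ (block _ _ e) _ Q _ (root (q-downA◇ _)) with block-injective h e
    ... | refl , refl = plain-match _ Q
    down-sound _ C _ (block _ _ e) _ Q _ (root (q-downA⊡ {s = s} _)) with block-injective h e
    ... | refl , refl = refl , refl , refl , regEq-onBlock C e (adjU V) (cong (_+ length s) (sym (d-◇c^ n C))) Q
    down-sound _ _ _ (block _ _ e) _ Q _ (root (q-downB⊡ _)) with block-injective h e
    ... | refl , refl = plain-match _ Q
    down-sound _ C _ (block _ _ e) _ Q _ (root (q-downB◇ {s = s} _)) with block-injective h e
    ... | refl , refl = refl , refl , refl , regEq-onBlock C e V (cong (_+ length s) (sym (d-⊡c^ n C))) Q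

    down : ∀ {X} (y : X ∈ (A ∷ B ∷ [])) {C t} → PosCtx C X → Determined (qr n A B h k V π₁ ρ) (oq (oroot y)) C t
    down y {C} {t} pc = down-outcome y C t (top? n t) , down-sound y C t (top? n t) pc

    lift₁ : ∀ {o C s} (out : Outcome π₁ (d C + length s)) → ¬ PosRoot o C → Sound π₁ o C s out →
            Sound (qr n A B h k V π₁ ρ) (oq o) C s (mapOutcome oq out)
    lift₁ out _ sound Q _ (q₁ st) = lift-match oq out (sound Q _ st)
    lift₁ _ np _ Q _ (root (q-downA◇ pc)) = ⊥-elim (np pc)
    lift₁ _ np _ Q _ (root (q-downA⊡ pc)) = ⊥-elim (np pc)
    lift₁ _ np _ Q _ (root (q-downB⊡ pc)) = ⊥-elim (np pc)
    lift₁ _ np _ Q _ (root (q-downB◇ pc)) = ⊥-elim (np pc)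

  -- Uniformity, by induction on the proof: a conclusion occurrence is
  -- handled by the last rule, an inner occurrence by the premise holding it.
  determined : ∀ {Γ} (π : Proof Γ) (o : Occ π) C s → CtxFor C (occF o) → Determined π o C s
  determined (ax A ρ)              (oroot x) C s _ = AxiomRule.root-determined A ρ x C s
  determined (cut A π₁ π₂ ρ)       (oroot x) C s _ = CutRule.root-determined A π₁ π₂ ρ x C s
  determined (par A B π₁ ρ)        (oroot x) C s _ = ParRule.root-determined A B π₁ ρ x C s
  determined (ten A B π₁ π₂ ρ)     (oroot x) C s _ = TensorRule.root-determined A B π₁ π₂ ρ x C s
  determined (qr n A B h k V π₁ ρ) (oroot x) C s _ = QuantumRule.root-determined n A B h k V π₁ ρ x C s
  determined (cut A π₁ π₂ ρ) (ocut₁ o) C s hc =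
    descend ocut₁ lift₁ down₁ o hc (determined π₁ o C s hc) where open CutRule A π₁ π₂ ρ
  determined (cut A π₁ π₂ ρ) (ocut₂ o) C s hc =
    descend ocut₂ lift₂ down₂ o hc (determined π₂ o C s hc) where open CutRule A π₁ π₂ ρ
  determined (par A B π₁ ρ) (opar o) C s hc =
    descend opar lift₁ down o hc (determined π₁ o C s hc) where open ParRule A B π₁ ρ
  determined (ten A B π₁ π₂ ρ) (oten₁ o) C s hc =
    descend oten₁ lift₁ down₁ o hc (determined π₁ o C s hc) where open TensorRule A B π₁ π₂ ρ
  determined (ten A B π₁ π₂ ρ) (oten₂ o) C s hc =
    descend oten₂ lift₂ down₂ o hc (determined π₂ o C s hc) where open TensorRule A B π₁ π₂ ρ
  determined (qr n A B h k V π₁ ρ) (oq o) C s hc =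
    descend oq lift₁ down o hc (determined π₁ o C s hc) where open QuantumRule n A B h k V π₁ ρ

lemma1 : ∀ {c ℓ : Level} (K : StarCommRing c ℓ) →
    let open QMLL K in
    ∀ {Γ : List Formula} (π : Proof Γ) (A : Occ π) (C : Ctx) (s : Stack) →
      CtxFor C (occF A) →
      Σ (Occ π) λ B → Σ Ctx λ D → Σ Stack λ r → Σ (Unitary (d C + length s)) λ U →
        ∀ (Q : Reg (d C + length s)) → IsUnitVector Q →
          ∀ (T : State π) → Step π ⟨ A , C , s , Q ⟩ T →
            (State.occ T ≡ B) × (State.ctx T ≡ D) × (State.stk T ≡ r) × RegEq (State.reg T) (applyU U Q)
lemma1 K π A C s hc =
  let open Transitions K
      (outcome B D r U , sound) = determined π A C s hc
  in B , D , r , U , λ Q _ T step → sound Q T step
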